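{- Let $I$ be a residuated lattice. The following are equivalent: (1) $I$ is a simple WNM-algebra; (2) $I$ has a coatom $u$ and its operations are given by: $x\odot y=0$ if $x,y<1$, $x\odot y=x$ if $y=1$, $x\odot y=y$ if $x=1$; and $x\rightarrow y=1$ if $x\le y$, $x\rightarrow y=y$ if $x=1$, $x\rightarrow y=u$ if $y<x<1$.
   Context: A residuated lattice is an algebra $\langle A,\wedge,\vee,\odot,\rightarrow,0,1\rangle$ of type $\langle2,2,2,2,0,0\rangle$ such that $\langle A,\odot,1\rangle$ is a commutative monoid, $\langle A,\vee,\wedge,0,1\rangle$ is a bounded lattice (order $\le$), and $a\odot b\le c$ iff $a\le b\rightarrow c$. Put $\neg x=x\rightarrow0$. An MTL-algebra is a residuated lattice satisfying $(x\rightarrow y)\vee(y\rightarrow x)=1$; a WNM-algebra is an MTL-algebra satisfying $\neg(x\odot y)\vee((x\wedge y)\rightarrow(x\odot y))=1$. An algebra is simple if its only congruences are the diagonal and the total congruence. A coatom is an element $u<1$ such that there is no $x$ with $u<x<1$.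
   Formalization: Condition (2) also demands that I be a chain, and a simple algebra must moreover satisfy 0 ≠ 1. Each condition added here is assumed in the paper as well or is needed for the statement above to hold. -}

module Defs where

open import Level using (Level; suc)
open import Data.Product using (Σ; _×_; _,_)
open import Data.Sum using (_⊎_)
open import Data.Empty using (⊥)
open import Relation.Nullary using (¬_)
open import Relation.Binary.PropositionalEquality using (_≡_; _≢_)
open import Relation.Binary.Core using (Rel)
open import Relation.Binary.Structures using (IsEquivalence)
open import Algebra.Core using (Op₂)
open import Algebra.Lattice.Structures using (IsLattice)
open import Algebra.Structures using (IsCommutativeMonoid)

record ResiduatedLattice (ℓ : Level) : Set (suc ℓ) where
  infixr 7 _⊙_
  infixr 6 _∧_
  infixr 5 _∨_
  infixr 4 _⇒_
  infix 3 _≤_ _<_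
  field
    Carrier : Set ℓ
    _∧_ _∨_ _⊙_ _⇒_ : Op₂ Carrier
    0# 1# : Carrier
    isLattice : IsLattice _≡_ _∨_ _∧_
    ∧-zero : ∀ x → x ∧ 0# ≡ 0#
    ∧-one  : ∀ x → x ∧ 1# ≡ x
    ⊙-isCommutativeMonoid : IsCommutativeMonoid _≡_ _⊙_ 1#

  _≤_ : Rel Carrier ℓ
  x ≤ y = x ∧ y ≡ x

  _<_ : Rel Carrier ℓ
  x < y = x ≤ y × x ≢ y

  field
    residuation₁ : ∀ a b c → a ⊙ b ≤ c → a ≤ (b ⇒ c)
    residuation₂ : ∀ a b c → a ≤ (b ⇒ c) → a ⊙ b ≤ c

  ¬′_ : Carrier → Carrier
  ¬′ x = x ⇒ 0#

module _ {ℓ : Level} (I : ResiduatedLattice ℓ) where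
  open ResiduatedLattice I

  IsMTL : Set ℓ
  IsMTL = ∀ x y → (x ⇒ y) ∨ (y ⇒ x) ≡ 1#

  IsWNM : Set ℓ
  IsWNM = IsMTL × (∀ x y → (¬′ (x ⊙ y)) ∨ ((x ∧ y) ⇒ (x ⊙ y)) ≡ 1#)

  record IsCongruence (θ : Rel Carrier ℓ) : Set ℓ where
    field
      isEquivalence : IsEquivalence θ
      ∧-compat : ∀ {x x′ y y′} → θ x x′ → θ y y′ → θ (x ∧ y) (x′ ∧ y′)
      ∨-compat : ∀ {x x′ y y′} → θ x x′ → θ y y′ → θ (x ∨ y) (x′ ∨ y′)
      ⊙-compat : ∀ {x x′ y y′} → θ x x′ → θ y y′ → θ (x ⊙ y) (x′ ⊙ y′)
      ⇒-compat : ∀ {x x′ y y′} → θ x x′ → θ y y′ → θ (x ⇒ y) (x′ ⇒ y′)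

  -- simple: exactly two congruences, the diagonal and the total one
  -- (nontriviality 0 ≠ 1 makes these two distinct)
  IsSimple : Set (suc ℓ)
  IsSimple = (0# ≢ 1#)
           × ((θ : Rel Carrier ℓ) → IsCongruence θ →
               (∀ x y → θ x y → x ≡ y) ⊎ (∀ x y → θ x y))

  IsCoatom : Carrier → Set ℓ
  IsCoatom u = u < 1# × (∀ x → u < x → x < 1# → ⊥)

  IsChain : Set ℓ
  IsChain = ∀ x y → x ≤ y ⊎ y ≤ x

  ProductTable : Set ℓ
  ProductTable = (∀ x y → x < 1# → y < 1# → x ⊙ y ≡ 0#)
               × (∀ x → x ⊙ 1# ≡ x)
               × (∀ y → 1# ⊙ y ≡ y)

  ImplicationTable : Carrier → Set ℓ
  ImplicationTable u = (∀ x y → x ≤ y → (x ⇒ y) ≡ 1#)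
                     × (∀ y → (1# ⇒ y) ≡ y)
                     × (∀ x y → y < x → x < 1# → (x ⇒ y) ≡ u)

  Condition2 : Set ℓ
  Condition2 = IsChain × Σ Carrier (λ u → IsCoatom u × ProductTable × ImplicationTable u)

-- For a ≠ 1, "aⁿ ⊙ x ≤ y and aⁿ ⊙ y ≤ x for some n" is a congruence identifying a
-- with 1, so in a simple residuated lattice every a ≠ 1 is nilpotent. Then a ∨ b = 1
-- forces aᵐ ∨ bⁿ = 1, so 1 is join-irreducible: prelinearity makes a simple
-- MTL-algebra a chain, and the WNM axiom at x = y makes every non-unit square to 0
-- (a nilpotent idempotent is 0); in a chain all products of non-units then vanish.
-- Once they do, x → y for y < x < 1 is the largest non-unit, i.e. the coatom.
-- Conversely, if non-units square to 0, a congruence relating 1 with some z ≠ 1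
-- relates 1 with z ⊙ z = 0, hence is total.
module Submission where

open import Defs
open import Level using (Level)
open import Data.Nat.Base using (ℕ; zero; suc; _+_)
open import Data.Product.Base using (_×_; _,_; proj₁; proj₂; ∃; ∃-syntax; swap)
open import Data.Sum.Base using (_⊎_; inj₁; inj₂)
open import Relation.Nullary using (¬_; yes; no; contradiction)
open import Relation.Binary.Core using (Rel)
open import Relation.Binary.PropositionalEquality
  using (_≡_; _≢_; refl; sym; trans; cong; cong₂; subst; subst₂; module ≡-Reasoning)
open import Relation.Binary.Structures using (IsEquivalence)
open import Function.Bundles using (_⇔_; mk⇔)
open import Axiom.ExcludedMiddle using (ExcludedMiddle)
open import Axiom.DoubleNegationElimination using (em⇒dne)
open import Algebra.Core using (Op₂)
open import Algebra.Bundles using (CommutativeMonoid)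
open import Algebra.Lattice.Bundles using (Lattice)
import Algebra.Lattice.Properties.Lattice as LatticeProperties
import Algebra.Properties.CommutativeSemigroup as CommutativeSemigroupProperties
import Algebra.Properties.Monoid.Mult as MonoidMult
import Relation.Binary.Lattice as OrderTheoretic
import Relation.Binary.Lattice.Properties.JoinSemilattice as JoinSemilatticeProperties

module _ {ℓ : Level} (I : ResiduatedLattice ℓ) where
  open ResiduatedLattice I

  private
    lattice : Lattice ℓ ℓ
    lattice = record { isLattice = isLattice }

    ⊙-commutativeMonoid : CommutativeMonoid ℓ ℓ
    ⊙-commutativeMonoid = record { isCommutativeMonoid = ⊙-isCommutativeMonoid }

    -- The library's lattice order is x ≡ x ∧ y, the symmetric form of _≤_.
    module Order = OrderTheoretic.Lattice
      (LatticeProperties.∨-∧-orderTheoreticLattice lattice)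
    module Join = JoinSemilatticeProperties Order.joinSemilattice
    module Power = MonoidMult (CommutativeMonoid.monoid ⊙-commutativeMonoid)

  open Lattice lattice using (∧-comm; ∨-comm)
  open LatticeProperties lattice using (∧-idem; ∨-idem)
  open CommutativeMonoid ⊙-commutativeMonoid
    using () renaming (assoc to ⊙-assoc; comm to ⊙-comm;
                       identityˡ to ⊙-identityˡ; identityʳ to ⊙-identityʳ)
  open CommutativeSemigroupProperties
    (CommutativeMonoid.commutativeSemigroup ⊙-commutativeMonoid) using (xy∙z≈y∙xz)

  ≤-refl : ∀ {x} → x ≤ x
  ≤-refl = sym Order.refl

  ≤-trans : ∀ {x y z} → x ≤ y → y ≤ z → x ≤ z
  ≤-trans x≤y y≤z = sym (Order.trans (sym x≤y) (sym y≤z))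

  ≤-antisym : ∀ {x y} → x ≤ y → y ≤ x → x ≡ y
  ≤-antisym x≤y y≤x = Order.antisym (sym x≤y) (sym y≤x)

  x≤1 : ∀ x → x ≤ 1#
  x≤1 = ∧-one

  0≤x : ∀ x → 0# ≤ x
  0≤x x = trans (∧-comm 0# x) (∧-zero x)

  x≤0⇒x≡0 : ∀ {x} → x ≤ 0# → x ≡ 0#
  x≤0⇒x≡0 {x} x≤0 = ≤-antisym x≤0 (0≤x x)

  x∧y≤x : ∀ x y → x ∧ y ≤ x
  x∧y≤x x y = sym (Order.x∧y≤x x y)

  x∧y≤y : ∀ x y → x ∧ y ≤ y
  x∧y≤y x y = sym (Order.x∧y≤y x y)

  ∧-greatest : ∀ {x y z} → x ≤ y → x ≤ z → x ≤ y ∧ z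
  ∧-greatest x≤y x≤z = sym (Order.∧-greatest (sym x≤y) (sym x≤z))

  x≤x∨y : ∀ x y → x ≤ x ∨ y
  x≤x∨y x y = sym (Order.x≤x∨y x y)

  y≤x∨y : ∀ x y → y ≤ x ∨ y
  y≤x∨y x y = sym (Order.y≤x∨y x y)

  x∨1≡1 : ∀ x → x ∨ 1# ≡ 1#
  x∨1≡1 x = Join.x≤y⇒x∨y≈y (sym (x≤1 x))

  1∨x≡1 : ∀ x → 1# ∨ x ≡ 1#
  1∨x≡1 x = trans (∨-comm 1# x) (x∨1≡1 x)

  ⊙-monoˡ-≤ : ∀ {x y} z → x ≤ y → x ⊙ z ≤ y ⊙ z
  ⊙-monoˡ-≤ {x} {y} z x≤y =
    residuation₂ x z (y ⊙ z) (≤-trans x≤y (residuation₁ y z (y ⊙ z) ≤-refl))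

  ⊙-monoʳ-≤ : ∀ {x y} z → x ≤ y → z ⊙ x ≤ z ⊙ y
  ⊙-monoʳ-≤ {x} {y} z x≤y = subst₂ _≤_ (⊙-comm x z) (⊙-comm y z) (⊙-monoˡ-≤ z x≤y)

  x⊙y≤x : ∀ x y → x ⊙ y ≤ x
  x⊙y≤x x y = subst (x ⊙ y ≤_) (⊙-identityʳ x) (⊙-monoʳ-≤ x (x≤1 y))

  x⊙y≤y : ∀ x y → x ⊙ y ≤ y
  x⊙y≤y x y = subst (_≤ y) (⊙-comm y x) (x⊙y≤x y x)

  [x⇒y]⊙x≤y : ∀ x y → (x ⇒ y) ⊙ x ≤ y
  [x⇒y]⊙x≤y x y = residuation₂ (x ⇒ y) x y ≤-refl

  ⊙-∨-least : ∀ {x y y′ z} → x ⊙ y ≤ z → x ⊙ y′ ≤ z → x ⊙ (y ∨ y′) ≤ z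
  ⊙-∨-least {x} {y} {y′} {z} xy≤z xy′≤z =
    subst (_≤ z) (⊙-comm (y ∨ y′) x) (residuation₂ (y ∨ y′) x z
      (sym (Order.∨-least (sym (residuation₁ y x z (subst (_≤ z) (⊙-comm x y) xy≤z)))
                          (sym (residuation₁ y′ x z (subst (_≤ z) (⊙-comm x y′) xy′≤z))))))

  ⇒≡1⁺ : ∀ {x y} → x ≤ y → (x ⇒ y) ≡ 1#
  ⇒≡1⁺ {x} {y} x≤y =
    ≤-antisym (x≤1 _) (residuation₁ 1# x y (subst (_≤ y) (sym (⊙-identityˡ x)) x≤y))

  ⇒≡1⁻ : ∀ {x y} → (x ⇒ y) ≡ 1# → x ≤ y
  ⇒≡1⁻ {x} {y} x⇒y≡1 =
    subst (_≤ y) (⊙-identityˡ x) (residuation₂ 1# x y (subst (1# ≤_) (sym x⇒y≡1) ≤-refl))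

  1⇒x≡x : ∀ x → (1# ⇒ x) ≡ x
  1⇒x≡x x = ≤-antisym (subst (_≤ x) (⊙-identityʳ _) ([x⇒y]⊙x≤y 1# x))
                      (residuation₁ x 1# x (subst (_≤ x) (sym (⊙-identityʳ x)) ≤-refl))

  infixr 8 _^_
  _^_ : Carrier → ℕ → Carrier
  a ^ n = n Power.× a

  infix 3 _≤[_]_ _≈[_]_

  -- x ≤[ a ] y is x ≤ y modulo the filter generated by a.
  _≤[_]_ : Carrier → Carrier → Carrier → Set ℓ
  x ≤[ a ] y = ∃[ n ] a ^ n ⊙ x ≤ y

  _≈[_]_ : Carrier → Carrier → Carrier → Set ℓ
  x ≈[ a ] y = x ≤[ a ] y × y ≤[ a ] x

  module _ {a : Carrier} where

    ≤[]-refl : ∀ {x} → x ≤[ a ] x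
    ≤[]-refl {x} = 0 , subst (_≤ x) (sym (⊙-identityˡ x)) ≤-refl

    ≤[]-trans : ∀ {x y z} → x ≤[ a ] y → y ≤[ a ] z → x ≤[ a ] z
    ≤[]-trans {x} {y} {z} (n , aⁿx≤y) (m , aᵐy≤z) = m + n ,
      subst (_≤ z) (sym (trans (cong (_⊙ x) (Power.×-homo-+ a m n)) (⊙-assoc _ _ x)))
        (≤-trans (⊙-monoʳ-≤ (a ^ m) aⁿx≤y) aᵐy≤z)

    ∧-monoˡ-≤[] : ∀ {x x′ y} → x ≤[ a ] x′ → x ∧ y ≤[ a ] x′ ∧ y
    ∧-monoˡ-≤[] {x} {x′} {y} (n , aⁿx≤x′) = n ,
      ∧-greatest (≤-trans (⊙-monoʳ-≤ (a ^ n) (x∧y≤x x y)) aⁿx≤x′)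
                 (≤-trans (x⊙y≤y (a ^ n) (x ∧ y)) (x∧y≤y x y))

    ∨-monoˡ-≤[] : ∀ {x x′ y} → x ≤[ a ] x′ → x ∨ y ≤[ a ] x′ ∨ y
    ∨-monoˡ-≤[] {x} {x′} {y} (n , aⁿx≤x′) = n ,
      ⊙-∨-least (≤-trans aⁿx≤x′ (x≤x∨y x′ y)) (≤-trans (x⊙y≤y (a ^ n) y) (y≤x∨y x′ y))

    ⊙-monoˡ-≤[] : ∀ {x x′ y} → x ≤[ a ] x′ → x ⊙ y ≤[ a ] x′ ⊙ y
    ⊙-monoˡ-≤[] {x} {x′} {y} (n , aⁿx≤x′) = n ,
      subst (_≤ x′ ⊙ y) (⊙-assoc (a ^ n) x y) (⊙-monoˡ-≤ y aⁿx≤x′)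

    ⇒-monoʳ-≤[] : ∀ {x y y′} → y ≤[ a ] y′ → x ⇒ y ≤[ a ] x ⇒ y′
    ⇒-monoʳ-≤[] {x} {y} {y′} (n , aⁿy≤y′) = n , residuation₁ _ x y′
      (subst (_≤ y′) (sym (⊙-assoc (a ^ n) (x ⇒ y) x))
        (≤-trans (⊙-monoʳ-≤ (a ^ n) ([x⇒y]⊙x≤y x y)) aⁿy≤y′))

    ⇒-antitoneˡ-≤[] : ∀ {x x′ y} → x′ ≤[ a ] x → x ⇒ y ≤[ a ] x′ ⇒ y
    ⇒-antitoneˡ-≤[] {x} {x′} {y} (n , aⁿx′≤x) = n , residuation₁ _ x′ y
      (subst (_≤ y) (sym (xy∙z≈y∙xz (a ^ n) (x ⇒ y) x′))
        (≤-trans (⊙-monoʳ-≤ (x ⇒ y) aⁿx′≤x) ([x⇒y]⊙x≤y x y)))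

    ≈[]-compatible : ∀ {_∙_ : Op₂ Carrier} → (∀ x y → x ∙ y ≡ y ∙ x) →
                     (∀ {x x′ y} → x ≤[ a ] x′ → x ∙ y ≤[ a ] x′ ∙ y) →
                     ∀ {x x′ y y′} → x ≈[ a ] x′ → y ≈[ a ] y′ → x ∙ y ≈[ a ] x′ ∙ y′
    ≈[]-compatible {_∙_} comm monoˡ (x≤x′ , x′≤x) (y≤y′ , y′≤y) =
      ≤[]-trans (monoˡ x≤x′) (monoʳ y≤y′) , ≤[]-trans (monoˡ x′≤x) (monoʳ y′≤y)
      where
      monoʳ : ∀ {x y y′} → y ≤[ a ] y′ → x ∙ y ≤[ a ] x ∙ y′
      monoʳ {x} {y} {y′} y≤y′ = subst₂ _≤[ a ]_ (comm y x) (comm y′ x) (monoˡ y≤y′)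

    ≈[]-isCongruence : IsCongruence I _≈[ a ]_
    ≈[]-isCongruence = record
      { isEquivalence = record
        { refl  = ≤[]-refl , ≤[]-refl
        ; sym   = swap
        ; trans = λ (x≤y , y≤x) (y≤z , z≤y) → ≤[]-trans x≤y y≤z , ≤[]-trans z≤y y≤x
        }
      ; ∧-compat = ≈[]-compatible ∧-comm ∧-monoˡ-≤[]
      ; ∨-compat = ≈[]-compatible ∨-comm ∨-monoˡ-≤[]
      ; ⊙-compat = ≈[]-compatible ⊙-comm ⊙-monoˡ-≤[]
      ; ⇒-compat = λ (x≤x′ , x′≤x) (y≤y′ , y′≤y) →
          ≤[]-trans (⇒-antitoneˡ-≤[] x′≤x) (⇒-monoʳ-≤[] y≤y′) ,
          ≤[]-trans (⇒-antitoneˡ-≤[] x≤x′) (⇒-monoʳ-≤[] y′≤y)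
      }

    a≈[a]1 : a ≈[ a ] 1#
    a≈[a]1 = (0 , x≤1 _) , (1 , ≤-trans (x⊙y≤x (a ⊙ 1#) 1#) (x⊙y≤x a 1#))

  ∨≡1-⊙ : ∀ {a b c} → a ∨ b ≡ 1# → a ∨ c ≡ 1# → a ∨ b ⊙ c ≡ 1#
  ∨≡1-⊙ {a} {b} {c} a∨b≡1 a∨c≡1 = ≤-antisym (x≤1 _)
    (subst (_≤ a ∨ b ⊙ c) (trans (cong₂ _⊙_ a∨b≡1 a∨c≡1) (⊙-identityˡ 1#)) bound)
    where
    bound : (a ∨ b) ⊙ (a ∨ c) ≤ a ∨ b ⊙ c
    bound = ⊙-∨-least
      (≤-trans (x⊙y≤y (a ∨ b) a) (x≤x∨y a (b ⊙ c)))
      (subst (_≤ a ∨ b ⊙ c) (⊙-comm c (a ∨ b)) (⊙-∨-least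
        (≤-trans (x⊙y≤y c a) (x≤x∨y a (b ⊙ c)))
        (subst (_≤ a ∨ b ⊙ c) (⊙-comm b c) (y≤x∨y a (b ⊙ c)))))

  ∨≡1-^ʳ : ∀ {a b} → a ∨ b ≡ 1# → ∀ n → a ∨ b ^ n ≡ 1#
  ∨≡1-^ʳ {a} a∨b≡1 zero    = x∨1≡1 a
  ∨≡1-^ʳ     a∨b≡1 (suc n) = ∨≡1-⊙ a∨b≡1 (∨≡1-^ʳ a∨b≡1 n)

  ∨≡1-^ : ∀ {a b} → a ∨ b ≡ 1# → ∀ m n → a ^ m ∨ b ^ n ≡ 1#
  ∨≡1-^ {a} {b} a∨b≡1 m n =
    trans (∨-comm (a ^ m) (b ^ n))
          (∨≡1-^ʳ (trans (∨-comm (b ^ n) a) (∨≡1-^ʳ a∨b≡1 n)) m)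

  idempotent∧nilpotent⇒≡0 : 0# ≢ 1# → ∀ {x} → x ⊙ x ≡ x → ∀ n → x ^ n ≡ 0# → x ≡ 0#
  idempotent∧nilpotent⇒≡0 0≢1 x²≡x zero    1≡0 = contradiction (sym 1≡0) 0≢1
  idempotent∧nilpotent⇒≡0 0≢1 x²≡x (suc n) xⁿ≡0 = trans (sym (Power.×-idem x²≡x (suc n))) xⁿ≡0

  simple⇒nilpotent : IsSimple I → ∀ {a} → a ≢ 1# → ∃[ n ] a ^ n ≡ 0#
  simple⇒nilpotent (_ , simple) {a} a≢1 with simple _≈[ a ]_ ≈[]-isCongruence
  ... | inj₁ diagonal = contradiction (diagonal a 1# a≈[a]1) a≢1
  ... | inj₂ total    =
    let n , aⁿ≤0 = proj₁ (total 1# 0#) in n , x≤0⇒x≡0 (subst (_≤ 0#) (⊙-identityʳ _) aⁿ≤0)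

  simple⇒1-joinIrreducible : ExcludedMiddle ℓ → IsSimple I →
                             ∀ {a b} → a ∨ b ≡ 1# → a ≡ 1# ⊎ b ≡ 1#
  simple⇒1-joinIrreducible em simple {a} {b} a∨b≡1 with em {a ≡ 1#} | em {b ≡ 1#}
  ... | yes a≡1 | _       = inj₁ a≡1
  ... | no _    | yes b≡1 = inj₂ b≡1
  ... | no a≢1  | no b≢1  =
    let m , aᵐ≡0 = simple⇒nilpotent simple a≢1
        n , bⁿ≡0 = simple⇒nilpotent simple b≢1
    in contradiction (begin
      0#            ≡⟨ ∨-idem 0# ⟨
      0# ∨ 0#       ≡⟨ cong₂ _∨_ aᵐ≡0 bⁿ≡0 ⟨
      a ^ m ∨ b ^ n ≡⟨ ∨≡1-^ a∨b≡1 m n ⟩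
      1#            ∎) (proj₁ simple)
    where open ≡-Reasoning

  simple∧MTL⇒chain : ExcludedMiddle ℓ → IsSimple I → IsMTL I → IsChain I
  simple∧MTL⇒chain em simple mtl x y with simple⇒1-joinIrreducible em simple (mtl x y)
  ... | inj₁ x⇒y≡1 = inj₁ (⇒≡1⁻ x⇒y≡1)
  ... | inj₂ y⇒x≡1 = inj₂ (⇒≡1⁻ y⇒x≡1)

  simple∧WNM⇒nonUnit²≡0 : ExcludedMiddle ℓ → IsSimple I → IsWNM I →
                          ∀ {x} → x ≢ 1# → x ⊙ x ≡ 0#
  simple∧WNM⇒nonUnit²≡0 em simple (_ , wnm) {x} x≢1
    with simple⇒1-joinIrreducible em simple
           (subst (λ t → ¬′ (x ⊙ x) ∨ (t ⇒ x ⊙ x) ≡ 1#) (∧-idem x) (wnm x x))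
  ... | inj₁ ¬x²≡1 = x≤0⇒x≡0 (⇒≡1⁻ ¬x²≡1)
  ... | inj₂ x⇒x²≡1 =
    let n , xⁿ≡0 = simple⇒nilpotent simple x≢1
    in trans x²≡x (idempotent∧nilpotent⇒≡0 (proj₁ simple) x²≡x n xⁿ≡0)
    where
    x²≡x : x ⊙ x ≡ x
    x²≡x = ≤-antisym (x⊙y≤x x x) (⇒≡1⁻ x⇒x²≡1)

  NonUnitsAnnihilate : Set ℓ
  NonUnitsAnnihilate = ∀ {x y} → x ≢ 1# → y ≢ 1# → x ⊙ y ≡ 0#

  chain⇒nonUnitsAnnihilate : IsChain I → (∀ {x} → x ≢ 1# → x ⊙ x ≡ 0#) → NonUnitsAnnihilate
  chain⇒nonUnitsAnnihilate chain x²≡0 {x} {y} x≢1 y≢1 with chain x y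
  ... | inj₁ x≤y = x≤0⇒x≡0 (subst (x ⊙ y ≤_) (x²≡0 y≢1) (⊙-monoˡ-≤ y x≤y))
  ... | inj₂ y≤x = x≤0⇒x≡0 (subst (x ⊙ y ≤_) (x²≡0 x≢1) (⊙-monoʳ-≤ x y≤x))

  IsGreatestNonUnit : Carrier → Set ℓ
  IsGreatestNonUnit g = g ≢ 1# × (∀ {z} → z ≢ 1# → z ≤ g)

  ⇒-isGreatestNonUnit : NonUnitsAnnihilate → ∀ {x y} → x ≢ 1# → ¬ (x ≤ y) →
                        IsGreatestNonUnit (x ⇒ y)
  ⇒-isGreatestNonUnit annihilate {x} {y} x≢1 x≰y =
    (λ x⇒y≡1 → x≰y (⇒≡1⁻ x⇒y≡1)) ,
    λ {z} z≢1 → residuation₁ z x y (subst (_≤ y) (sym (annihilate z≢1 x≢1)) (0≤x y))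

  greatestNonUnit-unique : ∀ {g h} → IsGreatestNonUnit g → IsGreatestNonUnit h → g ≡ h
  greatestNonUnit-unique (g≢1 , g-greatest) (h≢1 , h-greatest) =
    ≤-antisym (h-greatest g≢1) (g-greatest h≢1)

  greatestNonUnit⇒coatom : ∀ {g} → IsGreatestNonUnit g → IsCoatom I g
  greatestNonUnit⇒coatom {g} (g≢1 , greatest) =
    (x≤1 g , g≢1) , λ x (g≤x , g≢x) (_ , x≢1) → g≢x (≤-antisym g≤x (greatest x≢1))

  greatestNonUnit-exists : ExcludedMiddle ℓ → 0# ≢ 1# → NonUnitsAnnihilate →
                           ∃ IsGreatestNonUnit
  greatestNonUnit-exists em 0≢1 annihilate with em {∃[ w ] (w ≢ 1# × ¬ (w ≤ 0#))}
  ... | yes (w , w≢1 , w≰0) = (w ⇒ 0#) , ⇒-isGreatestNonUnit annihilate w≢1 w≰0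
  ... | no ∄w = 0# , 0≢1 , λ {z} z≢1 → em⇒dne em (λ z≰0 → ∄w (z , z≢1 , z≰0))

  nonUnitsAnnihilate⇒productTable : NonUnitsAnnihilate → ProductTable I
  nonUnitsAnnihilate⇒productTable annihilate =
    (λ x y (_ , x≢1) (_ , y≢1) → annihilate x≢1 y≢1) , ⊙-identityʳ , ⊙-identityˡ

  productTable⇒nonUnitsAnnihilate : ProductTable I → NonUnitsAnnihilate
  productTable⇒nonUnitsAnnihilate (annihilate , _) {x} {y} x≢1 y≢1 =
    annihilate x y (x≤1 x , x≢1) (x≤1 y , y≢1)

  greatestNonUnit⇒implicationTable : NonUnitsAnnihilate → ∀ {g} → IsGreatestNonUnit g →
                                     ImplicationTable I g
  greatestNonUnit⇒implicationTable annihilate g-greatest =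
    (λ _ _ → ⇒≡1⁺) , 1⇒x≡x ,
    λ x y (y≤x , y≢x) (_ , x≢1) → greatestNonUnit-unique
      (⇒-isGreatestNonUnit annihilate x≢1 (λ x≤y → y≢x (≤-antisym y≤x x≤y))) g-greatest

  chain⇒MTL : IsChain I → IsMTL I
  chain⇒MTL chain x y with chain x y
  ... | inj₁ x≤y = trans (cong (_∨ (y ⇒ x)) (⇒≡1⁺ x≤y)) (1∨x≡1 (y ⇒ x))
  ... | inj₂ y≤x = trans (cong ((x ⇒ y) ∨_) (⇒≡1⁺ y≤x)) (x∨1≡1 (x ⇒ y))

  nonUnitsAnnihilate⇒WNM-axiom : ExcludedMiddle ℓ → NonUnitsAnnihilate →
                                 ∀ x y → ¬′ (x ⊙ y) ∨ (x ∧ y ⇒ x ⊙ y) ≡ 1#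
  nonUnitsAnnihilate⇒WNM-axiom em annihilate x y with em {x ≡ 1#} | em {y ≡ 1#}
  ... | yes refl | _ = trans (cong (¬′ (1# ⊙ y) ∨_) (⇒≡1⁺
          (subst (1# ∧ y ≤_) (sym (⊙-identityˡ y)) (x∧y≤y 1# y)))) (x∨1≡1 _)
  ... | no _ | yes refl = trans (cong (¬′ (x ⊙ 1#) ∨_) (⇒≡1⁺
          (subst (x ∧ 1# ≤_) (sym (⊙-identityʳ x)) (x∧y≤x x 1#)))) (x∨1≡1 _)
  ... | no x≢1 | no y≢1 = begin
    ¬′ (x ⊙ y) ∨ (x ∧ y ⇒ x ⊙ y) ≡⟨ cong (λ t → ¬′ t ∨ (x ∧ y ⇒ x ⊙ y)) (annihilate x≢1 y≢1) ⟩
    ¬′ 0# ∨ (x ∧ y ⇒ x ⊙ y)      ≡⟨ cong (_∨ (x ∧ y ⇒ x ⊙ y)) (⇒≡1⁺ ≤-refl) ⟩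
    1# ∨ (x ∧ y ⇒ x ⊙ y)         ≡⟨ 1∨x≡1 (x ∧ y ⇒ x ⊙ y) ⟩
    1#                           ∎
    where open ≡-Reasoning

  congruence-1≈0⇒total : ∀ {θ} → IsCongruence I θ → θ 1# 0# → ∀ x y → θ x y
  congruence-1≈0⇒total {θ} congruence θ10 x y = θ-trans (θ-x0 x) (θ-sym (θ-x0 y))
    where
    open IsCongruence congruence
    open IsEquivalence isEquivalence renaming (refl to θ-refl; sym to θ-sym; trans to θ-trans)
    θ-x0 : ∀ x → θ x 0#
    θ-x0 x = subst₂ θ (∧-one x) (∧-zero x) (∧-compat θ-refl θ10)

  congruence-1≈⇒ : ∀ {θ} → IsCongruence I θ → ∀ {x y} → θ x y → θ 1# (y ⇒ x)
  congruence-1≈⇒ {θ} congruence θxy =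
    subst (λ t → θ t _) (⇒≡1⁺ ≤-refl) (⇒-compat θxy (IsEquivalence.refl isEquivalence))
    where open IsCongruence congruence

  congruence-nontrivial⇒1≈nonUnit : ExcludedMiddle ℓ → ∀ {θ} → IsCongruence I θ →
                                    ∀ {x y} → θ x y → x ≢ y → ∃[ z ] (z ≢ 1# × θ 1# z)
  congruence-nontrivial⇒1≈nonUnit em congruence {x} {y} θxy x≢y with em {x ≤ y}
  ... | yes x≤y = (y ⇒ x) , (λ y⇒x≡1 → x≢y (≤-antisym x≤y (⇒≡1⁻ y⇒x≡1))) ,
                  congruence-1≈⇒ congruence θxy
  ... | no x≰y  = (x ⇒ y) , (λ x⇒y≡1 → x≰y (⇒≡1⁻ x⇒y≡1)) ,
                  congruence-1≈⇒ congruence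
                    (IsEquivalence.sym (IsCongruence.isEquivalence congruence) θxy)

  nonUnit²≡0⇒simple : ExcludedMiddle ℓ → 0# ≢ 1# → (∀ {z} → z ≢ 1# → z ⊙ z ≡ 0#) →
                      IsSimple I
  nonUnit²≡0⇒simple em 0≢1 z²≡0 = 0≢1 , simple
    where
    simple : (θ : Rel Carrier ℓ) → IsCongruence I θ →
             (∀ x y → θ x y → x ≡ y) ⊎ (∀ x y → θ x y)
    simple θ congruence with em {∃[ x ] ∃[ y ] (θ x y × x ≢ y)}
    ... | yes (x , y , θxy , x≢y) =
      let z , z≢1 , θ1z = congruence-nontrivial⇒1≈nonUnit em congruence θxy x≢y
      in inj₂ (congruence-1≈0⇒total congruence
           (subst₂ θ (⊙-identityˡ 1#) (z²≡0 z≢1) (IsCongruence.⊙-compat congruence θ1z θ1z)))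
    ... | no ∄xy = inj₁ λ x y θxy → em⇒dne em (λ x≢y → ∄xy (x , y , θxy , x≢y))

  coatom⇒0≢1 : ∀ {u} → IsCoatom I u → 0# ≢ 1#
  coatom⇒0≢1 {u} ((u≤1 , u≢1) , _) 0≡1 =
    u≢1 (≤-antisym u≤1 (subst (_≤ u) 0≡1 (0≤x u)))

  simple∧WNM⇒condition2 : ExcludedMiddle ℓ → IsSimple I × IsWNM I → Condition2 I
  simple∧WNM⇒condition2 em (simple , wnm) =
    chain , g , greatestNonUnit⇒coatom g-greatest ,
    nonUnitsAnnihilate⇒productTable annihilate ,
    greatestNonUnit⇒implicationTable annihilate g-greatest
    where
    chain : IsChain I
    chain = simple∧MTL⇒chain em simple (proj₁ wnm)
    annihilate : NonUnitsAnnihilate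
    annihilate = chain⇒nonUnitsAnnihilate chain (simple∧WNM⇒nonUnit²≡0 em simple wnm)
    greatestNonUnit : ∃ IsGreatestNonUnit
    greatestNonUnit = greatestNonUnit-exists em (proj₁ simple) annihilate
    g = proj₁ greatestNonUnit
    g-greatest = proj₂ greatestNonUnit

  condition2⇒simple∧WNM : ExcludedMiddle ℓ → Condition2 I → IsSimple I × IsWNM I
  condition2⇒simple∧WNM em (chain , _ , u-coatom , productTable , _) =
    nonUnit²≡0⇒simple em (coatom⇒0≢1 u-coatom) (λ z≢1 → annihilate z≢1 z≢1) ,
    chain⇒MTL chain , nonUnitsAnnihilate⇒WNM-axiom em annihilate
    where
    annihilate : NonUnitsAnnihilate
    annihilate = productTable⇒nonUnitsAnnihilate productTable

theorem8p2 : {ℓ : Level} → ExcludedMiddle ℓ → (I : ResiduatedLattice ℓ) →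
    (IsSimple I × IsWNM I) ⇔ Condition2 I
theorem8p2 em I = mk⇔ (simple∧WNM⇒condition2 I em) (condition2⇒simple∧WNM I em)
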